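{- Let $B=(b_s)_{s=1}^m$ be a block sequence in ${\rm FIN}_l(n)$. Then for $2\leq k\leq l$ we have \[ T_1\left\langle\bigcup_{\vec{i}\in P_{k+1}^{l}} T_{\vec{i}}(B)\right\rangle_{P_{k}}=\left\langle\bigcup_{\vec{i}\in P_{k}^{l-1}} T_{\vec{i}}\circ T_1 (B)\right\rangle_{P_{k-1}}, \] where $T_1$ is applied elementwise to the set on the left. In particular, if $2\leq k=l$, then \[ T_1\left\langle B\right\rangle_{P_{k}}=\left\langle T_1 (B)\right\rangle_{P_{k-1}}. \]
   Context: Notation. $\mathbb{N}=\{1,2,3,\ldots\}$. For $p:\mathbb{N}\to\{0,1,\ldots,k\}$, ${\rm supp}(p)=\{l\in\mathbb{N}:p(l)\neq 0\}$. ${\rm FIN}_k$ is the set of such $p$ with finite support that take the value $k$ somewhere, and ${\rm FIN}_k(n)$ is the set of such $p$ with ${\rm supp}(p)\subset\{1,\ldots,n\}$. The partial addition $p+q$ (pointwise sum) is defined when $\max{\rm supp}(p)<\min{\rm supp}(q)$. A (finite) block sequence $(b_s)_{s=1}^m$ satisfies $\max{\rm supp}(b_s)<\min{\rm supp}(b_{s+1})$. Operations: for $0<i\leq k$, $T_i=T^{(k)}_i:{\rm FIN}_k\to{\rm FIN}_{k-1}$ is given by $T_i(p)(l)=p(l)$ if $p(l)<i$ and $T_i(p)(l)=p(l)-1$ if $p(l)\geq i$; $T_0$ is the identity. Let $[j]=\{0,1,\ldots,j\}$ and $P_k=\prod_{j=1}^k[j]$. For $l>k$, $P_{k+1}^l=\prod_{j=k+1}^{l}\{1,2,\ldots,j\}$,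 and $P_{k+1}^k$ contains only the constant sequence $\langle 0\rangle$ (so $P_k^{k-1}=\{\langle 0\rangle\}$ as well). For $\vec{i}=(i(1),\ldots,i(k))$ (or indexed $k+1,\ldots,l$) put $T_{\vec{i}}=T_{i(1)}\circ\cdots\circ T_{i(k)}$ (composition of the corresponding operations, each lowering the level by one unless it is $T_0$); thus for $p\in{\rm FIN}_l$ and $\vec{i}\in P^l_{k+1}$, $T_{\vec{i}}(p)\in{\rm FIN}_k$. For a block sequence $B=(b_s)_{s=1}^m$, $T_{\vec{i}}(B)=(T_{\vec{i}}(b_s))_{s=1}^m$. Semigroups: $\left\langle\bigcup_{\vec{i}\in P_{k+1}^{l}} T_{\vec{i}}(B)\right\rangle_{P_{k}}$ is the partial subsemigroup of ${\rm FIN}_k$ consisting of all elements $\sum_{s=1}^m T_{\vec{t}_s}\circ T_{\vec{i}_s}(b_s)$ with $\vec{i}_1,\ldots,\vec{i}_m\in P_{k+1}^l$, $\vec{t}_1,\ldots,\vec{t}_m\in P_k$, and at least one $\vec{t}_s$ equal to the zero vector $\prod_{j=1}^k\{0\}$. Analogously for the right-hand side, with $T_{\vec{i}}\circ T_1(b_s)$, $\vec{i}\in P_k^{l-1}$, and $\vec{t}_s\in P_{k-1}$. When $k=l$, $\bigcup_{\vec{i}\in P^k_{k+1}}T_{\vec{i}}(B)=B$, and $\langle B\rangle_{P_k}$ consists of the sums $\sum_{s} T_{\vec{t}_s}(b_s)$ with $\vec{t}_s\in P_k$, some $\vec{t}_s$ the zero vector. A previous lemma (used in the proof) states: for $1\leq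 j<k$ and $p\in{\rm FIN}_k$, $T_j\circ T_1(p)=T_1\circ T_{j+1}(p)$. -}

module Defs where

open import Data.Nat using (ℕ; zero; suc; _+_; _∸_; _≤_; _<_; _<ᵇ_)
open import Data.Bool using (if_then_else_)
open import Data.Fin using (Fin; toℕ)
import Data.Fin
open import Data.Vec using (Vec; []; _∷_; map; zipWith; replicate; lookup)
open import Data.Product using (Σ; _×_; ∃)
open import Relation.Binary.PropositionalEquality using (_≡_; _≢_)

-- Elements p : {1..n} → {0..k} are represented as vectors Vec ℕ n
-- (position j : Fin n stands for the integer toℕ j + 1).

T : ℕ → ℕ → ℕ
T zero    x = x
T (suc i) x = if x <ᵇ suc i then x else x ∸ 1

Tv : {n : ℕ} → ℕ → Vec ℕ n → Vec ℕ n
Tv i p = map (T i) p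

-- T_{vec i} = T_{i(1)} ∘ T_{i(2)} ∘ ... ∘ T_{i(r)}  (the last entry acts first).
Tvec : {r n : ℕ} → Vec ℕ r → Vec ℕ n → Vec ℕ n
Tvec []       p = p
Tvec (i ∷ is) p = Tv i (Tvec is p)

data Has (k : ℕ) : {n : ℕ} → Vec ℕ n → Set where
  here  : ∀ {n} {xs : Vec ℕ n} → Has k (k ∷ xs)
  there : ∀ {n x} {xs : Vec ℕ n} → Has k xs → Has k (x ∷ xs)

InFIN : (k : ℕ) {n : ℕ} → Vec ℕ n → Set
InFIN k {n} p = (∀ (j : Fin n) → lookup p j ≤ k) × Has k p

IsBlockSeqFIN : (l : ℕ) {m n : ℕ} → (Fin m → Vec ℕ n) → Set
IsBlockSeqFIN l {m} {n} B =
  (∀ s → InFIN l (B s)) ×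
  (∀ (s s' : Fin m) → toℕ s' ≡ suc (toℕ s) →
     ∀ (x y : Fin n) → lookup (B s) x ≢ 0 → lookup (B s') y ≢ 0 → toℕ x < toℕ y)

InP : (k : ℕ) → Vec ℕ k → Set
InP k v = ∀ (j : Fin k) → lookup v j ≤ suc (toℕ j)

-- vec ∈ P_{a+1}^{a+len} = ∏_{j=a+1}^{a+len} {1,..,j};
-- for len = 0 this is the single (empty) vector, acting as the identity ⟨0⟩.
InPr : (a len : ℕ) → Vec ℕ len → Set
InPr a len v = ∀ (j : Fin len) → (1 ≤ lookup v j) × (lookup v j ≤ a + suc (toℕ j))

sumV : {m n : ℕ} → (Fin m → Vec ℕ n) → Vec ℕ n
sumV {zero}  {n} f = replicate n 0
sumV {suc m} f = zipWith _+_ (f Data.Fin.zero) (sumV (λ s → f (Data.Fin.suc s)))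

-- x ∈ ⟨C⟩_{P_k}: x = Σ_{s=1}^m T_{t_s}(c_s), t_s ∈ P_k, some t_s the zero vector.
InSG : (k : ℕ) {m n : ℕ} → (Fin m → Vec ℕ n) → Vec ℕ n → Set
InSG k {m} C x =
  Σ (Fin m → Vec ℕ k) λ ts →
    (∀ s → InP k (ts s)) ×
    (∃ λ s → ts s ≡ replicate k 0) ×
    (x ≡ sumV (λ s → Tvec (ts s) (C s)))

-- x ∈ ⟨ ⋃_{vec i ∈ P_{a+1}^{a+len}} T_{vec i}(C) ⟩_{P_k}:
-- x = Σ_s T_{t_s} ∘ T_{i_s}(c_s) with i_s ∈ P_{a+1}^{a+len}, t_s ∈ P_k, some t_s zero.
InGen : (a len k : ℕ) {m n : ℕ} → (Fin m → Vec ℕ n) → Vec ℕ n → Set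
InGen a len k {m} C x =
  Σ (Fin m → Vec ℕ len) λ is →
    (∀ s → InPr a len (is s)) ×
    InSG k (λ s → Tvec (is s) (C s)) x

-- T₁ commutes with the other operations up to a change of index: T₁ ∘ T_{j+1} = T_j ∘ T₁
-- for j ≥ 1, and T₁ ∘ T₀ = T₀ ∘ T₁.  Pushing T₁ to the right through T_t ∘ T_i with
-- t ∈ P_k and i ∈ P_{k+1}^l therefore lowers the indices and yields T_{t'} ∘ T_{i'} ∘ T₁ with
-- t' ∈ P_{k-1} and i' ∈ P_k^{l-1}; when t(1) = 1 the extra T₁ is absorbed by the first zero
-- of the lowered vector, or the whole composite vanishes on FIN_k.  Conversely, raising the
-- indices of t', i' and prepending t(1) = 0 recovers a preimage.  Since the blocks have
-- disjoint supports and T₁ fixes 0, T₁ commutes with the sums that generate the semigroups,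
-- so the two sets correspond term by term.
module Submission where

open import Defs
open import Data.Bool using (true; false)
import Data.Bool as Bool
open import Data.Empty using (⊥-elim)
open import Data.Fin using (Fin; toℕ; fromℕ<) renaming (zero to fzero; suc to fsuc)
open import Data.Fin.Properties using (suc-injective; toℕ-injective; toℕ-fromℕ<; toℕ<n)
open import Data.Nat using (ℕ; zero; suc; _+_; _∸_; _≤_; _<_; _<ᵇ_; z≤n; s≤s; _≟_)
open import Data.Nat.Properties
  using (+-0-monoid; +-comm; +-suc; +-identityʳ; ≤-trans; ≤-pred; n≤1+n; <ᵇ⇒<; ∸-monoˡ-≤; n≤0⇒n≡0;
         m<n⇒n≢0; <-trans; m≤n+m; m∸n+n≡m; m+[n∸m]≡n; <-cmp; <-irrefl)
open import Algebra.Properties.Monoid.Sum +-0-monoid using (sum; sum-cong-≗; sum-replicate-zero)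
open import Data.Product using (Σ-syntax; ∃; _×_; _,_; proj₁; proj₂)
open import Data.Sum using (_⊎_; inj₁; inj₂; fromInj₂) renaming (map to map-⊎)
open import Data.Unit using (tt; ⊤)
open import Data.Vec using (Vec; []; _∷_; map; zipWith; replicate; lookup; tail)
open import Data.Vec.Properties using (lookup-map; lookup-zipWith; lookup-replicate; map-replicate; map-∘; map-cong; map-id)
open import Data.Vec.Relation.Binary.Pointwise.Extensional using (ext; Pointwise-≡⇒≡)
open import Data.Vec.Relation.Unary.All as All using (All; []; _∷_)
open import Data.Vec.Relation.Unary.All.Properties using (lookup⁺; lookup⁻; map⁺)
open import Function.Base using (_∘_)
open import Function.Bundles using (_⇔_; mk⇔; Equivalence)
import Function.Properties.Equivalence as ⇔
open import Relation.Binary.Definitions using (tri<; tri≈; tri>)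
open import Relation.Binary.PropositionalEquality
open import Relation.Nullary using (yes; no)

private
  variable
    c k m n r : ℕ

zeros : (k : ℕ) → Vec ℕ k
zeros k = replicate k 0

vec-ext : {u v : Vec ℕ n} → (∀ j → lookup u j ≡ lookup v j) → u ≡ v
vec-ext h = Pointwise-≡⇒≡ (ext h)

Tseq : Vec ℕ r → ℕ → ℕ
Tseq []       x = x
Tseq (i ∷ is) x = T i (Tseq is x)

lookup-Tvec : (w : Vec ℕ r) (p : Vec ℕ n) (j : Fin n) → lookup (Tvec w p) j ≡ Tseq w (lookup p j)
lookup-Tvec []      p j = refl
lookup-Tvec (i ∷ w) p j = trans (lookup-map j (T i) (Tvec w p)) (cong (T i) (lookup-Tvec w p j))

T-fixes-0 : ∀ i → T i 0 ≡ 0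
T-fixes-0 zero    = refl
T-fixes-0 (suc i) = refl

Tseq-fixes-0 : (w : Vec ℕ r) → Tseq w 0 ≡ 0
Tseq-fixes-0 []      = refl
Tseq-fixes-0 (i ∷ w) = trans (cong (T i) (Tseq-fixes-0 w)) (T-fixes-0 i)

lower : ℕ → ℕ
lower zero          = zero
lower (suc zero)    = suc zero
lower (suc (suc j)) = suc j

raise : ℕ → ℕ
raise zero    = zero
raise (suc j) = suc (suc j)

lower-raise : ∀ i → lower (raise i) ≡ i
lower-raise zero    = refl
lower-raise (suc i) = refl

lower-≤ : ∀ i → lower i ≤ i
lower-≤ zero          = z≤n
lower-≤ (suc zero)    = s≤s z≤n
lower-≤ (suc (suc j)) = n≤1+n (suc j)

T₁∘T : ∀ i x → T 1 (T i x) ≡ T (lower i) (T 1 x)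
T₁∘T zero          x       = refl
T₁∘T (suc zero)    x       = refl
T₁∘T (suc (suc j)) zero    = refl
T₁∘T (suc (suc j)) (suc x) with x <ᵇ suc j
... | true  = refl
... | false with x
...   | zero  = refl
...   | suc _ = refl

T₁∘Tseq : (w : Vec ℕ r) (x : ℕ) → T 1 (Tseq w x) ≡ Tseq (map lower w) (T 1 x)
T₁∘Tseq []      x = refl
T₁∘Tseq (i ∷ w) x = trans (T₁∘T i (Tseq w x)) (cong (T (lower i)) (T₁∘Tseq w x))

T₁∘Tseq-raise : (w : Vec ℕ r) (x : ℕ) → T 1 (Tseq (map raise w) x) ≡ Tseq w (T 1 x)
T₁∘Tseq-raise w x = trans (T₁∘Tseq (map raise w) x) (cong (λ v → Tseq v (T 1 x)) lower∘raise)
  where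
  lower∘raise : map lower (map raise w) ≡ w
  lower∘raise = trans (sym (map-∘ lower raise w)) (trans (map-cong lower-raise w) (map-id w))

T-≤ : ∀ {i y} → 1 ≤ i → i ≤ suc c → y ≤ suc c → T i y ≤ c
T-≤ {i = suc a} {y} _ a<1+c y≤1+c with y <ᵇ suc a in eq
... | true  = ≤-trans (≤-pred (<ᵇ⇒< y (suc a) (subst Bool.T (sym eq) tt))) (≤-pred a<1+c)
... | false = ∸-monoˡ-≤ 1 y≤1+c

T₁-≤ : ∀ {x} → x ≤ suc c → T 1 x ≤ c
T₁-≤ = T-≤ (s≤s z≤n) (s≤s z≤n)

-- The j-th entry (counting from 0) is at most c + j + 1: Bounded 0 is P_k, and
-- positive vectors satisfying Bounded a form P_{a+1}^{a+len}.
Bounded : ℕ → Vec ℕ r → Set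
Bounded c []       = ⊤
Bounded c (x ∷ xs) = x ≤ suc c × Bounded (suc c) xs

Positive : Vec ℕ r → Set
Positive = All (1 ≤_)

Bounded⇔ : {v : Vec ℕ r} → Bounded c v ⇔ (∀ j → lookup v j ≤ c + suc (toℕ j))
Bounded⇔ = mk⇔ to from
  where
  to : {v : Vec ℕ r} → Bounded c v → ∀ j → lookup v j ≤ c + suc (toℕ j)
  to {c = c} {v = x ∷ v} (x≤ , _) fzero    = subst (x ≤_) (+-comm 1 c) x≤
  to {c = c} {v = x ∷ v} (_ , b)  (fsuc j) = subst (lookup v j ≤_) (sym (+-suc c (suc (toℕ j)))) (to b j)
  from : {v : Vec ℕ r} → (∀ j → lookup v j ≤ c + suc (toℕ j)) → Bounded c v
  from {v = []}    h = tt
  from {c = c} {v = x ∷ v} h =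
    subst (x ≤_) (+-comm c 1) (h fzero) ,
    from (λ j → subst (lookup v j ≤_) (+-suc c (suc (toℕ j))) (h (fsuc j)))

InP⇔ : {v : Vec ℕ k} → InP k v ⇔ Bounded 0 v
InP⇔ = ⇔.sym Bounded⇔

InPr⇔ : ∀ {a len} {v : Vec ℕ len} → InPr a len v ⇔ (Positive v × Bounded a v)
InPr⇔ = mk⇔ (λ h → lookup⁻ (proj₁ ∘ h) , Equivalence.from Bounded⇔ (proj₂ ∘ h))
            (λ (pos , b) j → lookup⁺ pos j , Equivalence.to Bounded⇔ b j)

lower-Bounded : {v : Vec ℕ r} → Bounded (suc c) v → Bounded c (map lower v)
lower-Bounded {v = []}                  _       = tt
lower-Bounded {v = zero ∷ v}            (_ , b) = z≤n , lower-Bounded b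
lower-Bounded {v = suc zero ∷ v}        (_ , b) = s≤s z≤n , lower-Bounded b
lower-Bounded {v = suc (suc j) ∷ v}     (h , b) = ≤-pred h , lower-Bounded b

raise-Bounded : {v : Vec ℕ r} → Bounded c v → Bounded (suc c) (map raise v)
raise-Bounded {v = []}        _       = tt
raise-Bounded {v = zero ∷ v}  (_ , b) = z≤n , raise-Bounded b
raise-Bounded {v = suc j ∷ v} (h , b) = s≤s h , raise-Bounded b

lower-Positive : {v : Vec ℕ r} → Positive v → Positive (map lower v)
lower-Positive = map⁺ ∘ All.map λ { {suc i} _ → ≤-trans (s≤s z≤n) (lower-positive i) }
  where
  lower-positive : ∀ i → 1 ≤ lower (suc i)
  lower-positive zero    = s≤s z≤n
  lower-positive (suc i) = s≤s z≤n

raise-Positive : {v : Vec ℕ r} → Positive v → Positive (map raise v)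
raise-Positive = map⁺ ∘ All.map λ { {suc i} _ → s≤s z≤n }

-- Each T_i with 1 ≤ i ≤ c + 1 maps [0, c + 1] into [0, c].
Tseq-≤ : {w : Vec ℕ r} → ∀ {x} → Positive w → Bounded c w → x ≤ c + r → Tseq w x ≤ c
Tseq-≤ {c = c} {w = []}    {x} []          _         x≤ = subst (x ≤_) (+-identityʳ c) x≤
Tseq-≤ {suc r} {c} {i ∷ w} {x} (1≤i ∷ pos) (i≤ , b) x≤ =
  T-≤ 1≤i i≤ (Tseq-≤ pos b (subst (x ≤_) (+-suc c r) x≤))

-- T₁ moves right past the entries before the first zero of u, lowering them, and
-- then T₁ ∘ T₀ = T₁ ∘ T₁ replaces that zero by 1.
T₁-absorb : (u : Vec ℕ r) → Bounded c u →
  (Σ[ u' ∈ Vec ℕ r ] Bounded c u' × (∀ y → T 1 (Tseq u y) ≡ Tseq u' y)) ⊎ Positive u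
T₁-absorb []          _        = inj₂ []
T₁-absorb (zero ∷ u)  (_ , b)  = inj₁ (1 ∷ u , (s≤s z≤n , b) , λ y → refl)
T₁-absorb (suc i ∷ u) (i≤ , b) with T₁-absorb u b
... | inj₂ pos            = inj₂ (s≤s z≤n ∷ pos)
... | inj₁ (u' , b' , e)  = inj₁ (lower (suc i) ∷ u' , (≤-trans (lower-≤ (suc i)) i≤ , b') ,
                                  λ y → trans (T₁∘T (suc i) (Tseq u y)) (cong (T (lower (suc i))) (e y)))

record Lowering (t : Vec ℕ (suc k)) : Set where
  constructor lowering
  field
    lowered      : Vec ℕ k
    lowered∈P    : Bounded 0 lowered
    lowered-zero : t ≡ zeros (suc k) → lowered ≡ zeros k
    T₁∘T≡T∘T₁    : ∀ w → w ≤ suc k → T 1 (Tseq t w) ≡ Tseq lowered (T 1 w)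

T₁∘T-P : (t : Vec ℕ (suc k)) → Bounded 0 t → Lowering t
T₁∘T-P {k} (zero ∷ u) (_ , b) =
  lowering (map lower u) (lower-Bounded b)
           (λ t≡0 → trans (cong (map lower ∘ tail) t≡0) (map-replicate lower 0 k))
           (λ w _ → T₁∘Tseq u w)
T₁∘T-P {k} (suc zero ∷ u) (_ , b) with T₁-absorb (map lower u) (lower-Bounded b)
... | inj₁ (u' , b' , e) = lowering u' b' (λ ()) λ w _ → trans (cong (T 1) (T₁∘Tseq u w)) (e (T 1 w))
-- Otherwise all k entries of map lower u are positive, so both sides vanish on FIN_{k+1}.
... | inj₂ pos = lowering (map lower u) (lower-Bounded b) (λ ()) λ w w≤ →
  let vanishes = n≤0⇒n≡0 (Tseq-≤ pos (lower-Bounded b) (T₁-≤ w≤))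
  in trans (cong (T 1) (trans (T₁∘Tseq u w) vanishes)) (sym vanishes)
T₁∘T-P (suc (suc _) ∷ _) (s≤s () , _)

T₁-Tvec : (t : Vec ℕ r) (t' : Vec ℕ k) (p : Vec ℕ n) →
  (∀ j → T 1 (Tseq t (lookup p j)) ≡ Tseq t' (T 1 (lookup p j))) →
  Tv 1 (Tvec t p) ≡ Tvec t' (Tv 1 p)
T₁-Tvec t t' p h = vec-ext λ j → begin
  lookup (Tv 1 (Tvec t p)) j     ≡⟨ lookup-map j (T 1) (Tvec t p) ⟩
  T 1 (lookup (Tvec t p) j)      ≡⟨ cong (T 1) (lookup-Tvec t p j) ⟩
  T 1 (Tseq t (lookup p j))      ≡⟨ h j ⟩
  Tseq t' (T 1 (lookup p j))     ≡⟨ cong (Tseq t') (sym (lookup-map j (T 1) p)) ⟩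
  Tseq t' (lookup (Tv 1 p) j)    ≡⟨ sym (lookup-Tvec t' (Tv 1 p) j) ⟩
  lookup (Tvec t' (Tv 1 p)) j    ∎
  where open ≡-Reasoning

Disjoint : (Fin m → ℕ) → Set
Disjoint a = ∀ {s s'} → s ≢ s' → a s ≡ 0 ⊎ a s' ≡ 0

DisjointSupports : (Fin m → Vec ℕ n) → Set
DisjointSupports C = ∀ j → Disjoint (λ s → lookup (C s) j)

sum-zero : (a : Fin m → ℕ) → (∀ s → a s ≡ 0) → sum a ≡ 0
sum-zero {m} a h = trans (sum-cong-≗ h) (sum-replicate-zero m)

sum-map-disjoint : (g : ℕ → ℕ) → g 0 ≡ 0 → (a : Fin m → ℕ) → Disjoint a → g (sum a) ≡ sum (g ∘ a)
sum-map-disjoint {zero}  g g0 a _ = g0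
sum-map-disjoint {suc m} g g0 a d with a fzero ≟ 0
... | yes a₀≡0 = begin
  g (a fzero + sum (a ∘ fsuc))      ≡⟨ cong (λ z → g (z + sum (a ∘ fsuc))) a₀≡0 ⟩
  g (sum (a ∘ fsuc))                ≡⟨ sum-map-disjoint g g0 (a ∘ fsuc) (d ∘ suc-mono-≢) ⟩
  sum (g ∘ a ∘ fsuc)                ≡⟨ cong (_+ sum (g ∘ a ∘ fsuc)) (trans (sym g0) (cong g (sym a₀≡0))) ⟩
  g (a fzero) + sum (g ∘ a ∘ fsuc)  ∎
  where
  open ≡-Reasoning
  suc-mono-≢ : ∀ {s s'} → s ≢ s' → fsuc s ≢ fsuc s'
  suc-mono-≢ s≢s' = s≢s' ∘ suc-injective
... | no a₀≢0 = begin
  g (a fzero + sum (a ∘ fsuc))      ≡⟨ cong (λ z → g (a fzero + z)) (sum-zero (a ∘ fsuc) rest≡0) ⟩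
  g (a fzero + 0)                   ≡⟨ cong g (+-identityʳ (a fzero)) ⟩
  g (a fzero)                       ≡⟨ sym (+-identityʳ (g (a fzero))) ⟩
  g (a fzero) + 0                   ≡⟨ cong (g (a fzero) +_) (sym (sum-zero (g ∘ a ∘ fsuc) (λ s → trans (cong g (rest≡0 s)) g0))) ⟩
  g (a fzero) + sum (g ∘ a ∘ fsuc)  ∎
  where
  open ≡-Reasoning
  rest≡0 : ∀ s → a (fsuc s) ≡ 0
  rest≡0 s = fromInj₂ (⊥-elim ∘ a₀≢0) (d λ ())

lookup-sumV : (C : Fin m → Vec ℕ n) (j : Fin n) → lookup (sumV C) j ≡ sum (λ s → lookup (C s) j)
lookup-sumV {zero}  C j = lookup-replicate j 0
lookup-sumV {suc m} C j = trans (lookup-zipWith _+_ j (C fzero) (sumV (C ∘ fsuc)))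
                                (cong (lookup (C fzero) j +_) (lookup-sumV (C ∘ fsuc) j))

map-sumV-disjoint : (g : ℕ → ℕ) → g 0 ≡ 0 → (C : Fin m → Vec ℕ n) → DisjointSupports C →
  map g (sumV C) ≡ sumV (map g ∘ C)
map-sumV-disjoint g g0 C d = vec-ext λ j → begin
  lookup (map g (sumV C)) j         ≡⟨ lookup-map j g (sumV C) ⟩
  g (lookup (sumV C) j)             ≡⟨ cong g (lookup-sumV C j) ⟩
  g (sum (λ s → lookup (C s) j))    ≡⟨ sum-map-disjoint g g0 _ (d j) ⟩
  sum (λ s → g (lookup (C s) j))    ≡⟨ sum-cong-≗ (λ s → sym (lookup-map j g (C s))) ⟩
  sum (λ s → lookup (map g (C s)) j) ≡⟨ sym (lookup-sumV (map g ∘ C) j) ⟩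
  lookup (sumV (map g ∘ C)) j       ∎
  where open ≡-Reasoning

sumV-cong : {C D : Fin m → Vec ℕ n} → (∀ s → C s ≡ D s) → sumV C ≡ sumV D
sumV-cong {zero}  h = refl
sumV-cong {suc m} h = cong₂ (zipWith _+_) (h fzero) (sumV-cong (h ∘ fsuc))

DisjointSupports-Tvec : {C : Fin m → Vec ℕ n} (ts : Fin m → Vec ℕ r) → DisjointSupports C →
  DisjointSupports (λ s → Tvec (ts s) (C s))
DisjointSupports-Tvec {C = C} ts d j s≢s' = map-⊎ vanishes vanishes (d j s≢s')
  where
  vanishes : ∀ {s} → lookup (C s) j ≡ 0 → lookup (Tvec (ts s) (C s)) j ≡ 0
  vanishes {s} e = trans (lookup-Tvec (ts s) (C s) j) (trans (cong (Tseq (ts s)) e) (Tseq-fixes-0 (ts s)))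

InSG-cong : {C D : Fin m → Vec ℕ n} → (∀ s → C s ≡ D s) → ∀ {x} → InSG k C x → InSG k D x
InSG-cong C≡D (ts , bts , zero-term , x≡) =
  ts , bts , zero-term , trans x≡ (sumV-cong λ s → cong (Tvec (ts s)) (C≡D s))

T₁-InSG : 1 ≤ k → (C : Fin m → Vec ℕ n) → DisjointSupports C → (∀ s j → lookup (C s) j ≤ k) →
  ∀ y → (∃ λ x → InSG k C x × y ≡ Tv 1 x) ⇔ InSG (k ∸ 1) (λ s → Tv 1 (C s)) y
T₁-InSG {k = suc k} {m} _ C disjoint C≤ y = mk⇔ lower-terms raise-terms
  where
  open ≡-Reasoning
  open Lowering

  T₁-sumV : (ts : Fin m → Vec ℕ r) →
    Tv 1 (sumV λ s → Tvec (ts s) (C s)) ≡ sumV λ s → Tv 1 (Tvec (ts s) (C s))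
  T₁-sumV ts = map-sumV-disjoint (T 1) refl _ (DisjointSupports-Tvec ts disjoint)

  lower-terms : (∃ λ x → InSG (suc k) C x × y ≡ Tv 1 x) → InSG k (λ s → Tv 1 (C s)) y
  lower-terms (x , (ts , ts∈P , (s₀ , ts₀≡0) , x≡) , y≡) =
    ts' , (λ s → Equivalence.from InP⇔ (lowered∈P (L s))) , (s₀ , lowered-zero (L s₀) ts₀≡0) ,
    (begin
      y                                             ≡⟨ trans y≡ (cong (Tv 1) x≡) ⟩
      Tv 1 (sumV λ s → Tvec (ts s) (C s))           ≡⟨ T₁-sumV ts ⟩
      sumV (λ s → Tv 1 (Tvec (ts s) (C s)))         ≡⟨ sumV-cong (λ s → T₁-Tvec (ts s) (ts' s) (C s) λ j →
                                                         T₁∘T≡T∘T₁ (L s) _ (C≤ s j)) ⟩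
      sumV (λ s → Tvec (ts' s) (Tv 1 (C s)))        ∎)
    where
    L : ∀ s → Lowering (ts s)
    L s = T₁∘T-P (ts s) (Equivalence.to InP⇔ (ts∈P s))
    ts' : Fin m → Vec ℕ k
    ts' s = lowered (L s)

  raise-terms : InSG k (λ s → Tv 1 (C s)) y → ∃ λ x → InSG (suc k) C x × y ≡ Tv 1 x
  raise-terms (ts' , ts'∈P , (s₀ , ts'₀≡0) , y≡) =
    sumV (λ s → Tvec (ts s) (C s)) ,
    (ts , ts∈P , (s₀ , cong (0 ∷_) (trans (cong (map raise) ts'₀≡0) (map-replicate raise 0 k))) , refl) ,
    (begin
      y                                             ≡⟨ y≡ ⟩
      sumV (λ s → Tvec (ts' s) (Tv 1 (C s)))        ≡⟨ sumV-cong (λ s → sym (T₁-Tvec (ts s) (ts' s) (C s) λ j →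
                                                         T₁∘Tseq-raise (ts' s) (lookup (C s) j))) ⟩
      sumV (λ s → Tv 1 (Tvec (ts s) (C s)))         ≡⟨ sym (T₁-sumV ts) ⟩
      Tv 1 (sumV λ s → Tvec (ts s) (C s))           ∎)
    where
    ts : Fin m → Vec ℕ (suc k)
    ts s = 0 ∷ map raise (ts' s)
    ts∈P : ∀ s → InP (suc k) (ts s)
    ts∈P s = Equivalence.from InP⇔ (z≤n , raise-Bounded (Equivalence.to InP⇔ (ts'∈P s)))

T₁-InGen : ∀ {len} → 1 ≤ k → (B : Fin m → Vec ℕ n) → DisjointSupports B →
  (∀ s j → lookup (B s) j ≤ k + len) →
  ∀ y → (∃ λ x → InGen k len k B x × y ≡ Tv 1 x) ⇔ InGen (k ∸ 1) len (k ∸ 1) (λ s → Tv 1 (B s)) y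
T₁-InGen {k = suc k} {m} {len = len} 1≤k B disjoint B≤ y = mk⇔ lower-indices raise-indices
  where
  T₁-InSG-after : (is : Fin m → Vec ℕ len) → (∀ s → Positive (is s) × Bounded (suc k) (is s)) →
    (∃ λ x → InSG (suc k) (λ s → Tvec (is s) (B s)) x × y ≡ Tv 1 x) ⇔
    InSG k (λ s → Tv 1 (Tvec (is s) (B s))) y
  T₁-InSG-after is is∈P = T₁-InSG 1≤k _ (DisjointSupports-Tvec is disjoint) entries≤ y
    where
    entries≤ : ∀ s j → lookup (Tvec (is s) (B s)) j ≤ suc k
    entries≤ s j = subst (_≤ suc k) (sym (lookup-Tvec (is s) (B s) j))
                         (Tseq-≤ (proj₁ (is∈P s)) (proj₂ (is∈P s)) (B≤ s j))

  lower-indices : (∃ λ x → InGen (suc k) len (suc k) B x × y ≡ Tv 1 x) →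
    InGen k len k (λ s → Tv 1 (B s)) y
  lower-indices (x , (is , is∈P , x∈) , y≡) =
    map lower ∘ is ,
    (λ s → Equivalence.from InPr⇔ (lower-Positive (proj₁ (is∈P' s)) , lower-Bounded (proj₂ (is∈P' s)))) ,
    InSG-cong (λ s → T₁-Tvec (is s) (map lower (is s)) (B s) λ j → T₁∘Tseq (is s) (lookup (B s) j))
              (Equivalence.to (T₁-InSG-after is is∈P') (x , x∈ , y≡))
    where
    is∈P' : ∀ s → Positive (is s) × Bounded (suc k) (is s)
    is∈P' s = Equivalence.to InPr⇔ (is∈P s)

  raise-indices : InGen k len k (λ s → Tv 1 (B s)) y →
    ∃ λ x → InGen (suc k) len (suc k) B x × y ≡ Tv 1 x
  raise-indices (is' , is'∈P , y∈) =
    let x , x∈ , y≡ = Equivalence.from (T₁-InSG-after is is∈P)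
                        (InSG-cong (λ s → sym (T₁-Tvec (is s) (is' s) (B s) λ j → T₁∘Tseq-raise (is' s) (lookup (B s) j))) y∈)
    in x , (is , Equivalence.from InPr⇔ ∘ is∈P , x∈) , y≡
    where
    is : Fin m → Vec ℕ len
    is = map raise ∘ is'
    is∈P : ∀ s → Positive (is s) × Bounded (suc k) (is s)
    is∈P s = let pos , bnd = Equivalence.to InPr⇔ (is'∈P s) in raise-Positive pos , raise-Bounded bnd

Has⇒lookup : ∀ {x} {p : Vec ℕ n} → Has x p → ∃ λ j → lookup p j ≡ x
Has⇒lookup here = fzero , refl
Has⇒lookup (there h) = let j , e = Has⇒lookup h in fsuc j , e

module _ {l} {B : Fin m → Vec ℕ n} (blocks : IsBlockSeqFIN l B) (1≤l : 1 ≤ l) where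

  private
    nonzero-entry : ∀ s → ∃ λ x → lookup (B s) x ≢ 0
    nonzero-entry s = let x , e = Has⇒lookup (proj₂ (proj₁ blocks s)) in x , m<n⇒n≢0 1≤l ∘ trans (sym e)

    ordered-at-distance : ∀ d {s s'} → toℕ s' ≡ d + suc (toℕ s) → ∀ {x y} →
      lookup (B s) x ≢ 0 → lookup (B s') y ≢ 0 → toℕ x < toℕ y
    ordered-at-distance zero    s'≡ = proj₂ blocks _ _ s'≡ _ _
    ordered-at-distance (suc d) {s} {s'} s'≡ {x} Bsx≢0 Bs'y≢0 =
      <-trans (proj₂ blocks s middle (toℕ-fromℕ< middle<m) x z Bsx≢0 Bmz≢0)
              (ordered-at-distance d s'≡′ Bmz≢0 Bs'y≢0)
      where
      middle<m : suc (toℕ s) < m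
      middle<m = <-trans (subst (suc (toℕ s) <_) (sym s'≡) (s≤s (m≤n+m (suc (toℕ s)) d))) (toℕ<n s')
      middle = fromℕ< middle<m
      z = proj₁ (nonzero-entry middle)
      Bmz≢0 = proj₂ (nonzero-entry middle)
      s'≡′ : toℕ s' ≡ d + suc (toℕ middle)
      s'≡′ = trans s'≡ (trans (sym (+-suc d (suc (toℕ s))))
                              (cong (λ i → d + suc i) (sym (toℕ-fromℕ< middle<m))))

  blocks-ordered : ∀ {s s'} → toℕ s < toℕ s' → ∀ {x y} →
    lookup (B s) x ≢ 0 → lookup (B s') y ≢ 0 → toℕ x < toℕ y
  blocks-ordered {s} {s'} s<s' = ordered-at-distance (toℕ s' ∸ suc (toℕ s)) (sym (m∸n+n≡m s<s'))

  blocks-disjoint : DisjointSupports B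
  blocks-disjoint j {s} {s'} s≢s' with lookup (B s) j ≟ 0 | lookup (B s') j ≟ 0
  ... | yes Bsj≡0 | _          = inj₁ Bsj≡0
  ... | no _      | yes Bs'j≡0 = inj₂ Bs'j≡0
  ... | no Bsj≢0  | no Bs'j≢0 with <-cmp (toℕ s) (toℕ s')
  ...   | tri< s<s' _ _ = ⊥-elim (<-irrefl refl (blocks-ordered s<s' Bsj≢0 Bs'j≢0))
  ...   | tri≈ _ s≡s' _ = ⊥-elim (s≢s' (toℕ-injective s≡s'))
  ...   | tri> _ _ s>s' = ⊥-elim (<-irrefl refl (blocks-ordered s>s' Bs'j≢0 Bsj≢0))

lemma5p5 : {n m l : ℕ} (B : Fin m → Vec ℕ n) → IsBlockSeqFIN l B →
    ((k : ℕ) → 2 ≤ k → k ≤ l → (y : Vec ℕ n) →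
      (∃ (λ x → InGen k (l ∸ k) k B x × y ≡ Tv 1 x))
        ⇔ InGen (k ∸ 1) (l ∸ k) (k ∸ 1) (λ s → Tv 1 (B s)) y)
    ×
    (2 ≤ l → (y : Vec ℕ n) →
      (∃ (λ x → InSG l B x × y ≡ Tv 1 x)) ⇔ InSG (l ∸ 1) (λ s → Tv 1 (B s)) y)
lemma5p5 {l = l} B blocks =
  (λ k 2≤k k≤l → T₁-InGen (2≤⇒1≤ 2≤k) B (blocks-disjoint blocks (2≤⇒1≤ (≤-trans 2≤k k≤l)))
                   λ s j → subst (lookup (B s) j ≤_) (sym (m+[n∸m]≡n k≤l)) (entries≤l s j)) ,
  (λ 2≤l → T₁-InSG (2≤⇒1≤ 2≤l) B (blocks-disjoint blocks (2≤⇒1≤ 2≤l)) entries≤l)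
  where
  2≤⇒1≤ : ∀ {i} → 2 ≤ i → 1 ≤ i
  2≤⇒1≤ = ≤-trans (n≤1+n 1)
  entries≤l : ∀ s j → lookup (B s) j ≤ l
  entries≤l s = proj₁ (proj₁ blocks s)
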